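{- Let $t$ be a positive integer and let $\mathcal{A}$ be a finite family of finite sets with $|\mathcal{A}| > 1$, and let $r$ be the size of a largest set in $\mathcal{A}$. If $\mathcal{A}$ is not a trivial $t$-intersecting family, then, for some integer $p$ with $2 \leq p \leq \max\{2, r-t+2\}$, $\mathcal{A}$ has $p$ sets that have a union of size at most $m(r,t)$ and do not have $t$ common elements.
   Context: A set $A$ $t$-intersects a set $B$ if $|A \cap B| \ge t$. A family $\mathcal{A}$ is $t$-intersecting if every $A, B \in \mathcal{A}$ $t$-intersect; it is a trivial $t$-intersecting family if it is $t$-intersecting and $|\bigcap_{A \in \mathcal{A}} A| \geq t$. Define $m(r,t) := \max\{2r, \frac{(r-t)(r-t+5)}{2} + (t-1)\}$. -}

module Defs where

open import Data.Nat using (ℕ; suc; _≤_; _<_)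
open import Data.Integer as ℤ using (ℤ; +_)
open import Data.Fin using (Fin)
open import Data.Fin.Subset using (Subset; _∩_; ⋂; ∣_∣)
open import Data.List using (List)
open import Data.List.Base using (tabulate)
open import Data.Product using (_×_)

-- A finite set of elements is modelled as a subset of a finite ground set Fin n.
-- A finite family 𝒜 with k members is an injective enumeration F : Fin k → Subset n.

members : ∀ {n k} → (Fin k → Subset n) → List (Subset n)
members {k = k} F = tabulate F

_⟨_⟩-intersects_ : ∀ {n} → Subset n → ℕ → Subset n → Set
A ⟨ t ⟩-intersects B = t ≤ ∣ A ∩ B ∣

IsTIntersecting : ∀ {n k} → ℕ → (Fin k → Subset n) → Set
IsTIntersecting t F = ∀ i j → F i ⟨ t ⟩-intersects F j

IsTrivialTIntersecting : ∀ {n k} → ℕ → (Fin k → Subset n) → Set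
IsTrivialTIntersecting t F = IsTIntersecting t F × (t ≤ ∣ ⋂ (members F) ∣)

-- m(r,t) = max{2r, (r-t)(r-t+5)/2 + (t-1)}, computed in ℤ
-- ((r-t)(r-t+5) is always even, so the floor division is exact)
m : ℕ → ℕ → ℤ
m r t = (+ (2 Data.Nat.* r)) ℤ.⊔ ((d ℤ.* (d ℤ.+ + 5)) ℤ./ℕ 2 ℤ.+ (+ t ℤ.- + 1))
  where
  d : ℤ
  d = + r ℤ.- + t

module Submission where

-- If two members have fewer than t common elements they already work (p = 2, union
-- at most 2r).  Otherwise the family is t-intersecting with fewer than t common
-- elements, and deleting members while this persists ends in a critical family
-- A₁,…,A_p: fewer than t common elements, while each J_i = ⋂_{j≠i} A_j has at least t.
-- For a critical family with s common elements and union of size U, classifying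
-- every point of the ground set by the members that miss it gives
--   s(p-1) + (p-2)·Σ|J_i| + U ≤ s·p(p-2) + Σ|A_i|   and   s + Σ|J_i| ≤ s·p + U;
-- with Σ|A_i| ≤ pr, Σ|J_i| ≥ pt and s < t, arithmetic yields p ≤ r - t + 2 and
-- U ≤ m(r,t).

open import Defs
open import Data.Bool using (Bool; true; false; _∧_; _∨_)
open import Data.Bool.ListAction using (and; or)
open import Data.Nat using (ℕ; zero; suc; _≤_; _<_; _∸_; _+_; _*_; _/_; _⊔_; z≤n; s≤s; _≤?_)
open import Data.Nat.Properties
open import Data.Nat.DivMod using (m*n/n≡m; /-monoˡ-≤; +-distrib-/-∣ʳ)
open import Data.Nat.Divisibility using (divides)
open import Data.Nat.ListAction using (sum)
open import Data.Nat.Tactic.RingSolver using (solve-∀)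
import Data.Integer as ℤ
import Data.Integer.Properties as ℤP
open import Data.Fin using (Fin; zero; suc; punchIn; fromℕ<)
import Data.Fin.Properties as FinP
open import Data.Fin.Subset using (Subset; ⋃; ⋂; ∣_∣; _∩_)
open import Data.Fin.Subset.Properties using (∣p∣≤n; ∣⊤∣≡n; ∣p∩q∣≤∣p∣; ∩-identityʳ; ∩-idem)
open import Data.Vec as Vec using ([]; _∷_)
import Data.Vec.Properties as VecP
open import Data.List using (List; []; _∷_; map; length; allFin; lookup)
import Data.List.Properties as LP
open import Data.List.Membership.Propositional.Properties using (∈-lookup)
open import Data.List.Relation.Unary.All as All using (All; []; _∷_)
import Data.List.Relation.Unary.All.Properties as AllP
open import Data.List.Relation.Unary.Any using (Any; here; there)
import Data.List.Relation.Unary.Any.Properties as AnyP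
open import Data.List.Relation.Unary.AllPairs using ([]; _∷_)
open import Data.List.Relation.Unary.Unique.Propositional using (Unique)
import Data.List.Relation.Unary.Unique.Propositional.Properties as UniqueP
open import Data.Product using (Σ; _×_; _,_; proj₁; proj₂)
open import Data.Empty using (⊥-elim)
open import Function using (_∘_)
open import Function.Definitions using (Injective)
open import Relation.Binary.PropositionalEquality
open import Relation.Nullary using (¬_; yes; no)
open import Relation.Unary using (Decidable)
open import Algebra.Properties.Semiring.Sum +-*-semiring
  using (sum-syntax; ∑-distrib-+; *-distribʳ-sum; sum-cong-≗; sum-replicate-zero)

-- The members of a family that contain a point x form a list
-- of bits; the statistics of the family (intersection, union, sizes, leave-one-out
-- intersections) are sums over x of simple functions of this pattern.

bit : Bool → ℕ
bit true = 1
bit false = 0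

bit≤1 : ∀ b → bit b ≤ 1
bit≤1 true = ≤-refl
bit≤1 false = z≤n

trues : List Bool → ℕ
trues [] = 0
trues (b ∷ bs) = bit b + trues bs

leaveOneOut : ∀ {A : Set} → List A → List (List A)
leaveOneOut [] = []
leaveOneOut (x ∷ xs) = xs ∷ map (x ∷_) (leaveOneOut xs)

leaveOneOut-map : ∀ {A B : Set} (f : A → B) (xs : List A) →
  leaveOneOut (map f xs) ≡ map (map f) (leaveOneOut xs)
leaveOneOut-map f [] = refl
leaveOneOut-map f (x ∷ xs) = cong (map f xs ∷_) (begin
  map (f x ∷_) (leaveOneOut (map f xs))       ≡⟨ cong (map (f x ∷_)) (leaveOneOut-map f xs) ⟩
  map (f x ∷_) (map (map f) (leaveOneOut xs)) ≡⟨ sym (LP.map-∘ (leaveOneOut xs)) ⟩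
  map (map f ∘ (x ∷_)) (leaveOneOut xs)      ≡⟨ LP.map-∘ (leaveOneOut xs) ⟩
  map (map f) (map (x ∷_) (leaveOneOut xs))   ∎)
  where open ≡-Reasoning

length-leaveOneOut : ∀ {A : Set} (xs : List A) → length (leaveOneOut xs) ≡ length xs
length-leaveOneOut [] = refl
length-leaveOneOut (x ∷ xs) =
  cong suc (trans (LP.length-map (x ∷_) (leaveOneOut xs)) (length-leaveOneOut xs))

almostAll : List Bool → ℕ
almostAll bs = trues (map and (leaveOneOut bs))

almostAll-true : ∀ bs → almostAll (true ∷ bs) ≡ bit (and bs) + almostAll bs
almostAll-true bs = cong (λ n → bit (and bs) + trues n) (sym (LP.map-∘ (leaveOneOut bs)))

almostAll-false : ∀ bs → almostAll (false ∷ bs) ≡ bit (and bs)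
almostAll-false bs = trans (cong (bit (and bs) +_) (none (leaveOneOut bs))) (+-identityʳ _)
  where
  none : ∀ bss → trues (map and (map (false ∷_) bss)) ≡ 0
  none [] = refl
  none (_ ∷ bss) = none bss

data Shape (bs : List Bool) : Set where
  complete    : and bs ≡ true  → trues bs ≡ length bs → almostAll bs ≡ length bs → Shape bs
  oneMissing  : and bs ≡ false → almostAll bs ≡ 1 → suc (trues bs) ≡ length bs → Shape bs
  manyMissing : and bs ≡ false → almostAll bs ≡ 0 → Shape bs

shape : ∀ bs → Shape bs
shape [] = complete refl refl refl
shape (true ∷ bs) with shape bs
... | complete a c d   = complete a (cong suc c) (trans (almostAll-true bs) (cong₂ _+_ (cong bit a) d))
... | oneMissing a d c = oneMissing a (trans (almostAll-true bs) (cong₂ _+_ (cong bit a) d)) (cong suc c)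
... | manyMissing a d  = manyMissing a (trans (almostAll-true bs) (cong₂ _+_ (cong bit a) d))
shape (false ∷ bs) with shape bs
... | complete a c _   = oneMissing refl (trans (almostAll-false bs) (cong bit a)) (cong suc c)
... | oneMissing a _ _ = manyMissing refl (trans (almostAll-false bs) (cong bit a))
... | manyMissing a _  = manyMissing refl (trans (almostAll-false bs) (cong bit a))

or≤trues : ∀ bs → bit (or bs) ≤ trues bs
or≤trues [] = z≤n
or≤trues (true ∷ bs) = s≤s z≤n
or≤trues (false ∷ bs) = or≤trues bs

or-set : ∀ bs → 1 ≤ trues bs → bit (or bs) ≡ 1
or-set (true ∷ bs) _ = refl
or-set (false ∷ bs) h = or-set bs h

pattern-count₁ : ∀ q bs → length bs ≡ 2 + q →
  bit (and bs) * suc q + (almostAll bs * q + bit (or bs)) ≤ bit (and bs) * (q * (2 + q)) + trues bs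
pattern-count₁ q bs len with shape bs
... | complete a c d rewrite a | c | d | len =
  ≤-trans (+-monoʳ-≤ (suc q + 0) (+-monoʳ-≤ ((2 + q) * q) (bit≤1 (or bs)))) (≤-reflexive (identity q))
  where
  identity : ∀ q → suc q + 0 + ((2 + q) * q + 1) ≡ q * (2 + q) + 0 + (2 + q)
  identity = solve-∀
... | oneMissing a d c rewrite a | d = begin
  q + 0 + bit (or bs) ≤⟨ +-mono-≤ (≤-reflexive (+-identityʳ q)) (bit≤1 (or bs)) ⟩
  q + 1               ≡⟨ +-comm q 1 ⟩
  suc q               ≡⟨ suc-injective (trans c len) ⟨
  trues bs            ∎
  where open ≤-Reasoning
... | manyMissing a d rewrite a | d = or≤trues bs

pattern-count₂ : ∀ q bs → length bs ≡ 2 + q →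
  bit (and bs) + almostAll bs ≤ bit (and bs) * (2 + q) + bit (or bs)
pattern-count₂ q bs len with shape bs
... | complete a c d rewrite a | d | or-set bs (subst (1 ≤_) (sym (trans c len)) (s≤s z≤n)) | len =
  ≤-reflexive (identity q)
  where
  identity : ∀ q → suc (2 + q) ≡ 2 + q + 0 + 1
  identity = solve-∀
... | oneMissing a d c
  rewrite a | d | or-set bs (subst (1 ≤_) (sym (suc-injective (trans c len))) (s≤s z≤n)) = ≤-refl
... | manyMissing a d rewrite a | d = z≤n

-- Summation over the ground set Fin n.

∑-mono : ∀ {n} {f g : Fin n → ℕ} → (∀ x → f x ≤ g x) → ∑[ x < n ] f x ≤ ∑[ x < n ] g x
∑-mono {zero} _ = z≤n
∑-mono {suc n} f≤g = +-mono-≤ (f≤g zero) (∑-mono (f≤g ∘ suc))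

∑-affine : ∀ {n} (f g : Fin n → ℕ) c →
  ∑[ x < n ] (f x * c + g x) ≡ (∑[ x < n ] f x) * c + ∑[ x < n ] g x
∑-affine f g c = trans (∑-distrib-+ (λ x → f x * c) g) (cong (_+ _) (sym (*-distribʳ-sum c f)))

profile : ∀ {n} → List (Subset n) → Fin n → List Bool
profile as x = map (λ A → Vec.lookup A x) as

∣∣≡∑ : ∀ {n} (S : Subset n) → ∣ S ∣ ≡ ∑[ x < n ] bit (Vec.lookup S x)
∣∣≡∑ [] = refl
∣∣≡∑ (true ∷ S) = cong suc (∣∣≡∑ S)
∣∣≡∑ (false ∷ S) = ∣∣≡∑ S

lookup-⋂ : ∀ {n} (as : List (Subset n)) x → Vec.lookup (⋂ as) x ≡ and (profile as x)
lookup-⋂ [] x = VecP.lookup-replicate x true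
lookup-⋂ (A ∷ as) x = trans (VecP.lookup-zipWith _ x A (⋂ as)) (cong (Vec.lookup A x ∧_) (lookup-⋂ as x))

lookup-⋃ : ∀ {n} (as : List (Subset n)) x → Vec.lookup (⋃ as) x ≡ or (profile as x)
lookup-⋃ [] x = VecP.lookup-replicate x false
lookup-⋃ (A ∷ as) x = trans (VecP.lookup-zipWith _ x A (⋃ as)) (cong (Vec.lookup A x ∨_) (lookup-⋃ as x))

∣⋂∣≡∑ : ∀ {n} (as : List (Subset n)) → ∣ ⋂ as ∣ ≡ ∑[ x < n ] bit (and (profile as x))
∣⋂∣≡∑ as = trans (∣∣≡∑ (⋂ as)) (sum-cong-≗ (cong bit ∘ lookup-⋂ as))

∣⋃∣≡∑ : ∀ {n} (as : List (Subset n)) → ∣ ⋃ as ∣ ≡ ∑[ x < n ] bit (or (profile as x))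
∣⋃∣≡∑ as = trans (∣∣≡∑ (⋃ as)) (sum-cong-≗ (cong bit ∘ lookup-⋃ as))

sizes≡∑ : ∀ {n} (as : List (Subset n)) → sum (map ∣_∣ as) ≡ ∑[ x < n ] trues (profile as x)
sizes≡∑ {n} [] = sym (sum-replicate-zero n)
sizes≡∑ (A ∷ as) = trans (cong₂ _+_ (∣∣≡∑ A) (sizes≡∑ as))
  (sym (∑-distrib-+ (λ x → bit (Vec.lookup A x)) (λ x → trues (profile as x))))

profile-leaveOneOut : ∀ {n} (as : List (Subset n)) x →
  profile (map ⋂ (leaveOneOut as)) x ≡ map and (leaveOneOut (profile as x))
profile-leaveOneOut as x = begin
  map (λ A → Vec.lookup A x) (map ⋂ (leaveOneOut as))
    ≡⟨ LP.map-∘ (leaveOneOut as) ⟨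
  map (λ bs → Vec.lookup (⋂ bs) x) (leaveOneOut as)
    ≡⟨ LP.map-cong (λ bs → lookup-⋂ bs x) (leaveOneOut as) ⟩
  map (λ bs → and (profile bs x)) (leaveOneOut as)
    ≡⟨ LP.map-∘ (leaveOneOut as) ⟩
  map and (map (λ bs → profile bs x) (leaveOneOut as))
    ≡⟨ cong (map and) (leaveOneOut-map _ as) ⟨
  map and (leaveOneOut (profile as x)) ∎
  where open ≡-Reasoning

leaveOneOut-sizes≡∑ : ∀ {n} (as : List (Subset n)) →
  sum (map ∣_∣ (map ⋂ (leaveOneOut as))) ≡ ∑[ x < n ] almostAll (profile as x)
leaveOneOut-sizes≡∑ as =
  trans (sizes≡∑ (map ⋂ (leaveOneOut as))) (sum-cong-≗ (λ x → cong trues (profile-leaveOneOut as x)))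

module _ {n : ℕ} (as : List (Subset n)) where
  private
    common union size missing : Fin n → ℕ
    common x = bit (and (profile as x))
    union x = bit (or (profile as x))
    size x = trues (profile as x)
    missing x = almostAll (profile as x)

  counting₁ : ∀ q → length as ≡ 2 + q →
    ∣ ⋂ as ∣ * suc q + (sum (map ∣_∣ (map ⋂ (leaveOneOut as))) * q + ∣ ⋃ as ∣)
      ≤ ∣ ⋂ as ∣ * (q * (2 + q)) + sum (map ∣_∣ as)
  counting₁ q len rewrite ∣⋂∣≡∑ as | ∣⋃∣≡∑ as | sizes≡∑ as | leaveOneOut-sizes≡∑ as = begin
    (∑[ x < n ] common x) * suc q + ((∑[ x < n ] missing x) * q + ∑[ x < n ] union x)
      ≡⟨ cong ((∑[ x < n ] common x) * suc q +_) (∑-affine missing union q) ⟨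
    (∑[ x < n ] common x) * suc q + ∑[ x < n ] (missing x * q + union x)
      ≡⟨ ∑-affine common (λ x → missing x * q + union x) (suc q) ⟨
    ∑[ x < n ] (common x * suc q + (missing x * q + union x))
      ≤⟨ ∑-mono (λ x → pattern-count₁ q (profile as x) (trans (LP.length-map _ as) len)) ⟩
    ∑[ x < n ] (common x * (q * (2 + q)) + size x)
      ≡⟨ ∑-affine common size (q * (2 + q)) ⟩
    (∑[ x < n ] common x) * (q * (2 + q)) + ∑[ x < n ] size x ∎
    where open ≤-Reasoning

  counting₂ : ∀ q → length as ≡ 2 + q →
    ∣ ⋂ as ∣ + sum (map ∣_∣ (map ⋂ (leaveOneOut as))) ≤ ∣ ⋂ as ∣ * (2 + q) + ∣ ⋃ as ∣
  counting₂ q len rewrite ∣⋂∣≡∑ as | ∣⋃∣≡∑ as | leaveOneOut-sizes≡∑ as = begin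
    (∑[ x < n ] common x) + ∑[ x < n ] missing x
      ≡⟨ ∑-distrib-+ common missing ⟨
    ∑[ x < n ] (common x + missing x)
      ≤⟨ ∑-mono (λ x → pattern-count₂ q (profile as x) (trans (LP.length-map _ as) len)) ⟩
    ∑[ x < n ] (common x * (2 + q) + union x)
      ≡⟨ ∑-affine common union (2 + q) ⟩
    (∑[ x < n ] common x) * (2 + q) + ∑[ x < n ] union x ∎
    where open ≤-Reasoning

  union≤sizes : ∣ ⋃ as ∣ ≤ sum (map ∣_∣ as)
  union≤sizes rewrite ∣⋃∣≡∑ as | sizes≡∑ as = ∑-mono (λ x → or≤trues (profile as x))

-- Arithmetic.

cancel-common : ∀ {a b c x y : ℕ} → x ≡ a + c → y ≡ b + c → x ≤ y → a ≤ b
cancel-common {a} {b} {c} refl refl = +-cancelʳ-≤ c a b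

doubled-bound : ∀ {u x y z} w → x + u ≤ y → z + x * 2 ≡ y * 2 + w → u * 2 ≤ z
doubled-bound {u} {x} {y} {z} w x+u≤y eq = +-cancelʳ-≤ (x * 2) (u * 2) z (begin
  u * 2 + x * 2 ≡⟨ *-distribʳ-+ 2 u x ⟨
  (u + x) * 2   ≡⟨ cong (_* 2) (+-comm u x) ⟩
  (x + u) * 2   ≤⟨ *-monoˡ-≤ 2 x+u≤y ⟩
  y * 2         ≤⟨ m≤m+n (y * 2) w ⟩
  y * 2 + w     ≡⟨ eq ⟨
  z + x * 2     ∎)
  where open ≤-Reasoning

halve : ∀ a b c → a * 2 ≤ c + b * 2 → a ≤ c / 2 + b
halve a b c h = begin
  a                   ≡⟨ m*n/n≡m a 2 ⟨
  a * 2 / 2           ≤⟨ /-monoˡ-≤ 2 h ⟩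
  (c + b * 2) / 2     ≡⟨ +-distrib-/-∣ʳ c (divides b refl) ⟩
  c / 2 + b * 2 / 2   ≡⟨ cong (c / 2 +_) (m*n/n≡m b 2) ⟩
  c / 2 + b           ∎
  where open ≤-Reasoning

m-unfold : ∀ t d → 1 ≤ t → m (t + d) t ≡ ℤ.+ (2 * (t + d)) ℤ.⊔ ℤ.+ (d * (d + 5) / 2 + (t ∸ 1))
m-unfold t d 1≤t = begin
  m (t + d) t
    ≡⟨ cong₂ (λ d′ t′ → ℤ.+ (2 * (t + d)) ℤ.⊔ ((d′ ℤ.* (d′ ℤ.+ ℤ.+ 5)) ℤ./ℕ 2 ℤ.+ t′)) r-t t-1 ⟩
  ℤ.+ (2 * (t + d)) ℤ.⊔ ((ℤ.+ d ℤ.* ℤ.+ (d + 5)) ℤ./ℕ 2 ℤ.+ ℤ.+ (t ∸ 1))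
    ≡⟨ cong (λ z → ℤ.+ (2 * (t + d)) ℤ.⊔ (z ℤ./ℕ 2 ℤ.+ ℤ.+ (t ∸ 1))) (ℤP.pos-* d (d + 5)) ⟨
  ℤ.+ (2 * (t + d)) ℤ.⊔ ℤ.+ (d * (d + 5) / 2 + (t ∸ 1)) ∎
  where
  open ≡-Reasoning
  r-t : ℤ.+ (t + d) ℤ.- ℤ.+ t ≡ ℤ.+ d
  r-t = trans (ℤP.m-n≡m⊖n (t + d) t) (trans (ℤP.⊖-≥ (m≤m+n t d)) (cong ℤ.+_ (m+n∸m≡n t d)))
  t-1 : ℤ.+ t ℤ.- ℤ.+ 1 ≡ ℤ.+ (t ∸ 1)
  t-1 = trans (ℤP.m-n≡m⊖n t 1) (ℤP.⊖-≥ 1≤t)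

-- The setting of the arithmetic: a family of p = 2 + q sets of size at most r,
-- with s common elements, union of size U, sizes summing to SA and leave-one-out
-- intersections of sizes summing to SJ, each at least t = 1 + s + u.
-- Adding the two counting inequalities eliminates U and yields q + t ≤ r.
critical-size : ∀ q s u U SA SJ r →
  s * suc q + (SJ * q + U) ≤ s * (q * (2 + q)) + SA →
  s + SJ ≤ s * (2 + q) + U →
  SA ≤ (2 + q) * r → (2 + q) * suc (s + u) ≤ SJ →
  q + suc (s + u) ≤ r
critical-size q s u U SA SJ r count₁ count₂ sizes≤ leaveOneOut≥ =
  ≤-trans (m≤m+n (q + t) (u * q)) (cancel-common (excess q s u) refl (*-cancelˡ-≤ (2 + q) scaled))
  where
  t : ℕ
  t = suc (s + u)
  without-union : s * (2 + q) + SJ * suc q ≤ SA + s * (suc q * (2 + q))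
  without-union = cancel-common (lhs q s SJ U) (rhs q s SA U) (+-mono-≤ count₁ count₂)
    where
    lhs : ∀ q s SJ U → s * suc q + (SJ * q + U) + (s + SJ) ≡ s * (2 + q) + SJ * suc q + U
    lhs = solve-∀
    rhs : ∀ q s SA U → s * (q * (2 + q)) + SA + (s * (2 + q) + U) ≡ SA + s * (suc q * (2 + q)) + U
    rhs = solve-∀
  scaled : (2 + q) * (s + t * suc q) ≤ (2 + q) * (r + s * suc q)
  scaled = begin
    (2 + q) * (s + t * suc q)           ≡⟨ expand₁ q s t ⟩
    s * (2 + q) + (2 + q) * t * suc q   ≤⟨ +-monoʳ-≤ (s * (2 + q)) (*-monoˡ-≤ (suc q) leaveOneOut≥) ⟩
    s * (2 + q) + SJ * suc q            ≤⟨ without-union ⟩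
    SA + s * (suc q * (2 + q))          ≤⟨ +-monoˡ-≤ (s * (suc q * (2 + q))) sizes≤ ⟩
    (2 + q) * r + s * (suc q * (2 + q)) ≡⟨ expand₂ q r s ⟩
    (2 + q) * (r + s * suc q)           ∎
    where
    open ≤-Reasoning
    expand₁ : ∀ q s t → (2 + q) * (s + t * suc q) ≡ s * (2 + q) + (2 + q) * t * suc q
    expand₁ = solve-∀
    expand₂ : ∀ q r s → (2 + q) * r + s * (suc q * (2 + q)) ≡ (2 + q) * (r + s * suc q)
    expand₂ = solve-∀
  excess : ∀ q s u → s + suc (s + u) * suc q ≡ q + suc (s + u) + u * q + s * suc q
  excess = solve-∀

-- For p = 3 + Q ≥ 3 sets the first counting inequality bounds the union by
-- d(d+5)/2 + (t - 1), where r = t + d (and d ≥ p - 2 by critical-size).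
critical-union : ∀ Q e s u U SA SJ →
  s * (2 + Q) + (SJ * suc Q + U) ≤ s * (suc Q * (3 + Q)) + SA →
  SA ≤ (3 + Q) * (suc (s + u) + (suc Q + e)) → (3 + Q) * suc (s + u) ≤ SJ →
  U ≤ (suc Q + e) * (suc Q + e + 5) / 2 + (s + u)
critical-union Q e s u U SA SJ count₁ sizes≤ leaveOneOut≥ =
  halve U (s + u) ((suc Q + e) * (suc Q + e + 5))
    (doubled-bound {u = U} (u * 2 + Q * (3 + Q) * u * 2 + 5 * Q + e + Q * Q + e * e)
      bounded (identity Q e s u))
  where
  t : ℕ
  t = suc (s + u)
  bounded : s * (2 + Q) + (3 + Q) * t * suc Q + U ≤ s * (suc Q * (3 + Q)) + (3 + Q) * (t + (suc Q + e))
  bounded = begin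
    s * (2 + Q) + (3 + Q) * t * suc Q + U
      ≡⟨ +-assoc (s * (2 + Q)) _ U ⟩
    s * (2 + Q) + ((3 + Q) * t * suc Q + U)
      ≤⟨ +-monoʳ-≤ (s * (2 + Q)) (+-monoˡ-≤ U (*-monoˡ-≤ (suc Q) leaveOneOut≥)) ⟩
    s * (2 + Q) + (SJ * suc Q + U)
      ≤⟨ count₁ ⟩
    s * (suc Q * (3 + Q)) + SA
      ≤⟨ +-monoʳ-≤ (s * (suc Q * (3 + Q))) sizes≤ ⟩
    s * (suc Q * (3 + Q)) + (3 + Q) * (t + (suc Q + e)) ∎
    where open ≤-Reasoning
  identity : ∀ Q e s u →
    (suc Q + e) * (suc Q + e + 5) + (s + u) * 2 + (s * (2 + Q) + (3 + Q) * suc (s + u) * suc Q) * 2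
      ≡ (s * (suc Q * (3 + Q)) + (3 + Q) * (suc (s + u) + (suc Q + e))) * 2
        + (u * 2 + Q * (3 + Q) * u * 2 + 5 * Q + e + Q * Q + e * e)
  identity = solve-∀

critical-bounds : ∀ q s t U SA SJ r → s < t →
  s * suc q + (SJ * q + U) ≤ s * (q * (2 + q)) + SA →
  s + SJ ≤ s * (2 + q) + U →
  SA ≤ (2 + q) * r → (2 + q) * t ≤ SJ → U ≤ SA →
  (2 + q ≤ r ∸ t + 2) × (ℤ.+ U ℤ.≤ m r t)
critical-bounds q s t U SA SJ r s<t count₁ count₂ sizes≤ leaveOneOut≥ U≤SA
  with m≤n⇒∃[o]m+o≡n s<t
... | u , refl
  with m≤n⇒∃[o]m+o≡n
         (≤-trans (m≤n+m t q) (critical-size q s u U SA SJ r count₁ count₂ sizes≤ leaveOneOut≥))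
... | d , refl = size-bound , union-bound q q≤d count₁ sizes≤ leaveOneOut≥
  where
  q+t≤r : q + t ≤ t + d
  q+t≤r = critical-size q s u U SA SJ (t + d) count₁ count₂ sizes≤ leaveOneOut≥
  q≤d : q ≤ d
  q≤d = +-cancelʳ-≤ t q d (subst (q + t ≤_) (+-comm t d) q+t≤r)
  size-bound : 2 + q ≤ t + d ∸ t + 2
  size-bound rewrite m+n∸m≡n t d = subst (_≤ d + 2) (+-comm q 2) (+-monoˡ-≤ 2 q≤d)
  union-bound : ∀ q → q ≤ d →
    s * suc q + (SJ * q + U) ≤ s * (q * (2 + q)) + SA →
    SA ≤ (2 + q) * (t + d) → (2 + q) * t ≤ SJ → ℤ.+ U ℤ.≤ m (t + d) t
  union-bound zero _ _ sizes≤ _ = ℤP.i≤j⇒i≤j⊔k _ (ℤ.+≤+ (≤-trans U≤SA sizes≤))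
  union-bound (suc Q) Q<d count₁ sizes≤ leaveOneOut≥ with m≤n⇒∃[o]m+o≡n Q<d
  ... | e , refl = subst (ℤ.+ U ℤ.≤_) (sym (m-unfold t d (s≤s z≤n)))
    (ℤP.i≤j⇒i≤k⊔j (ℤ.+ (2 * (t + d))) (ℤ.+≤+ (critical-union Q e s u U SA SJ count₁ sizes≤ leaveOneOut≥)))

-- Critical families.

sum≤length* : ∀ {r} (xs : List ℕ) → All (_≤ r) xs → sum xs ≤ length xs * r
sum≤length* [] [] = z≤n
sum≤length* (_ ∷ xs) (x≤r ∷ xs≤r) = +-mono-≤ x≤r (sum≤length* xs xs≤r)

length*≤sum : ∀ {t} (xs : List ℕ) → All (t ≤_) xs → length xs * t ≤ sum xs
length*≤sum [] [] = z≤n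
length*≤sum (_ ∷ xs) (t≤x ∷ t≤xs) = +-mono-≤ t≤x (length*≤sum xs t≤xs)

critical-family : ∀ {n} q r t (as : List (Subset n)) → length as ≡ 2 + q →
  All (λ A → ∣ A ∣ ≤ r) as → ∣ ⋂ as ∣ < t → All (λ J → t ≤ ∣ J ∣) (map ⋂ (leaveOneOut as)) →
  (2 + q ≤ r ∸ t + 2) × (ℤ.+ ∣ ⋃ as ∣ ℤ.≤ m r t)
critical-family q r t as len small few large =
  critical-bounds q (∣ ⋂ as ∣) t (∣ ⋃ as ∣) _ _ r few
    (counting₁ as q len) (counting₂ as q len) sizes≤ leaveOneOut≥ (union≤sizes as)
  where
  sizes≤ : sum (map ∣_∣ as) ≤ (2 + q) * r
  sizes≤ = subst (λ p → sum (map ∣_∣ as) ≤ p * r) (trans (LP.length-map ∣_∣ as) len)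
             (sum≤length* (map ∣_∣ as) (AllP.map⁺ small))
  leaveOneOut≥ : (2 + q) * t ≤ sum (map ∣_∣ (map ⋂ (leaveOneOut as)))
  leaveOneOut≥ = subst (λ p → p * t ≤ sum (map ∣_∣ (map ⋂ (leaveOneOut as))))
    (trans (LP.length-map ∣_∣ (map ⋂ (leaveOneOut as)))
      (trans (LP.length-map ⋂ (leaveOneOut as)) (trans (length-leaveOneOut as) len)))
    (length*≤sum (map ∣_∣ (map ⋂ (leaveOneOut as))) (AllP.map⁺ large))

-- Search for a critical subfamily.

module _ {A : Set} where

  leaveOneOut-witness : (Q : List A → Set) (xs : List A) → Any Q (leaveOneOut xs) →
    Σ (List A) λ ys → Q ys × length ys < length xs
      × (∀ {P : A → Set} → All P xs → All P ys) × (Unique xs → Unique ys)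
  leaveOneOut-witness Q (x ∷ xs) (here q) =
    xs , q , ≤-refl , (λ { (_ ∷ ps) → ps }) , (λ { (_ ∷ u) → u })
  leaveOneOut-witness Q (x ∷ xs) (there qs) with leaveOneOut-witness (Q ∘ (x ∷_)) xs (AnyP.map⁻ qs)
  ... | ys , q , shorter , keep , unique =
    x ∷ ys , q , s≤s shorter , (λ { (p ∷ ps) → p ∷ keep ps }) , (λ { (x∉ ∷ u) → keep x∉ ∷ unique u })

  minimal-bad : {Good : List A → Set} → Decidable Good → (xs : List A) → Unique xs → ¬ Good xs →
    Σ (List A) λ ys → Unique ys × ¬ Good ys × All Good (leaveOneOut ys)
  minimal-bad {Good} good? xs = search (length xs) xs ≤-refl
    where
    search : ∀ bound xs → length xs ≤ bound → Unique xs → ¬ Good xs →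
      Σ (List A) λ ys → Unique ys × ¬ Good ys × All Good (leaveOneOut ys)
    search zero [] _ u bad = [] , u , bad , []
    search (suc bound) xs len u bad with All.all? good? (leaveOneOut xs)
    ... | yes good = xs , u , bad , good
    ... | no notAll with leaveOneOut-witness (¬_ ∘ Good) xs (AllP.¬All⇒Any¬ good? _ notAll)
    ...   | ys , badYs , shorter , _ , unique =
      search bound ys (≤-pred (≤-trans shorter len)) (unique u) badYs

lookup-injective : ∀ {A : Set} (xs : List A) → Unique xs → Injective _≡_ _≡_ (lookup xs)
lookup-injective (x ∷ xs) (_ ∷ u) {zero} {zero} _ = refl
lookup-injective (x ∷ xs) (x∉ ∷ _) {zero} {suc j} eq = ⊥-elim (All.lookup x∉ (∈-lookup j) eq)
lookup-injective (x ∷ xs) (x∉ ∷ _) {suc i} {zero} eq = ⊥-elim (All.lookup x∉ (∈-lookup i) (sym eq))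
lookup-injective (x ∷ xs) (_ ∷ u) {suc i} {suc j} eq = cong suc (lookup-injective xs u eq)

another : ∀ {k} → 1 < k → (i : Fin k) → Σ (Fin k) (λ j → i ≢ j)
another (s≤s (s≤s _)) i = punchIn i zero , FinP.punchInᵢ≢i i zero ∘ sym

failing-pair : ∀ {n k} t (F : Fin k → Subset n) → ¬ IsTIntersecting t F →
  Σ (Fin k) λ i → Σ (Fin k) λ j → ∣ F i ∩ F j ∣ < t
failing-pair {k = k} t F notPairwise
  with FinP.¬∀⟶∃¬ k _ (λ i → FinP.all? (λ j → t ≤? ∣ F i ∩ F j ∣)) notPairwise
... | i , notRow with FinP.¬∀⟶∃¬ k _ (λ j → t ≤? ∣ F i ∩ F j ∣) notRow
...   | j , fails = i , j , ≰⇒> fails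

module _ {n k : ℕ} (t r : ℕ) (F : Fin k → Subset n) (bounded : ∀ i → ∣ F i ∣ ≤ r) where

  Witness : Set
  Witness = Σ ℕ λ p → 2 ≤ p × p ≤ 2 ⊔ (r ∸ t + 2)
    × Σ (Fin p → Fin k) λ g → Injective _≡_ _≡_ g
      × (ℤ.+ ∣ ⋃ (members (λ j → F (g j))) ∣ ℤ.≤ m r t)
      × (∣ ⋂ (members (λ j → F (g j))) ∣ < t)

  witness : (zs : List (Fin k)) → Unique zs → 2 ≤ length zs → length zs ≤ 2 ⊔ (r ∸ t + 2) →
    ℤ.+ ∣ ⋃ (map F zs) ∣ ℤ.≤ m r t → ∣ ⋂ (map F zs) ∣ < t → Witness
  witness zs unique long short union few =
    length zs , long , short , lookup zs , lookup-injective zs unique ,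
    subst (λ as → ℤ.+ ∣ ⋃ as ∣ ℤ.≤ m r t) (sym members≡) union ,
    subst (λ as → ∣ ⋂ as ∣ < t) (sym members≡) few
    where
    members≡ : members (λ j → F (lookup zs j)) ≡ map F zs
    members≡ = trans (sym (LP.map-tabulate (lookup zs) F)) (cong (map F) (LP.tabulate-lookup zs))

  pair-witness : ∀ {i j} → i ≢ j → ∣ F i ∩ F j ∣ < t → Witness
  pair-witness {i} {j} i≢j few = witness (i ∷ j ∷ []) ((i≢j ∷ []) ∷ [] ∷ []) ≤-refl (m≤m⊔n 2 (r ∸ t + 2))
    (ℤP.i≤j⇒i≤j⊔k _ (ℤ.+≤+ (≤-trans (union≤sizes (F i ∷ F j ∷ []))
      (+-mono-≤ (bounded i) (+-mono-≤ (bounded j) z≤n)))))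
    (subst (λ B → ∣ F i ∩ B ∣ < t) (sym (∩-identityʳ (F j))) few)

  -- Any two members, equal or not, with fewer than t common elements yield a witness:
  -- a member with fewer than t elements may be paired with any other member.
  non-intersecting : 1 < k → ∀ i j → ∣ F i ∩ F j ∣ < t → Witness
  non-intersecting 1<k i j few with i FinP.≟ j
  ... | no i≢j = pair-witness i≢j few
  ... | yes refl with another 1<k i
  ...   | j′ , i≢j′ = pair-witness i≢j′
          (≤-<-trans (∣p∩q∣≤∣p∣ (F i) (F j′)) (subst (_< t) (cong ∣_∣ (∩-idem (F i))) few))

  -- A t-intersecting family with fewer than t common elements contains a critical
  -- subfamily; by t-intersection it has at least two members, so critical-family applies.
  intersecting : 1 < k → IsTIntersecting t F → ∣ ⋂ (map F (allFin k)) ∣ < t → Witness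
  intersecting 1<k pairwise few
    with minimal-bad (λ ys → t ≤? ∣ ⋂ (map F ys) ∣) (allFin k) (UniqueP.allFin⁺ k) (<⇒≱ few)
  ... | [] , _ , bad , _ =
    ⊥-elim (bad (subst (t ≤_) (sym (∣⊤∣≡n n)) (≤-trans (pairwise i i) (∣p∣≤n (F i ∩ F i)))))
    where
    i : Fin k
    i = fromℕ< (≤-trans (s≤s z≤n) 1<k)
  ... | a ∷ [] , _ , bad , _ =
    ⊥-elim (bad (subst (λ A → t ≤ ∣ A ∣) (trans (∩-idem (F a)) (sym (∩-identityʳ (F a)))) (pairwise a a)))
  ... | zs@(_ ∷ _ ∷ rest) , unique , bad , good =
    witness zs unique (s≤s (s≤s z≤n)) (m≤n⇒m≤o⊔n 2 (proj₁ bounds)) (proj₂ bounds) (≰⇒> bad)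
    where
    large : All (λ J → t ≤ ∣ J ∣) (map ⋂ (leaveOneOut (map F zs)))
    large = subst (λ L → All (λ J → t ≤ ∣ J ∣) (map ⋂ L)) (sym (leaveOneOut-map F zs))
              (AllP.map⁺ (AllP.map⁺ good))
    bounds : (length zs ≤ r ∸ t + 2) × (ℤ.+ ∣ ⋃ (map F zs) ∣ ℤ.≤ m r t)
    bounds = critical-family (length rest) r t (map F zs) (LP.length-map F zs)
               (AllP.map⁺ (All.universal bounded zs)) (≰⇒> bad) large

lemma3p1 : (n t k r : ℕ) → 1 ≤ t → (F : Fin k → Subset n) → Injective _≡_ _≡_ F → 1 < k
    → (Σ (Fin k) λ i → ∣ F i ∣ ≡ r) → (∀ i → ∣ F i ∣ ≤ r)
    → ¬ IsTrivialTIntersecting t F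
    → Σ ℕ λ p → 2 ≤ p × p ≤ 2 ⊔ (r ∸ t + 2)
      × Σ (Fin p → Fin k) λ g → Injective _≡_ _≡_ g
        × (ℤ.+ ∣ ⋃ (members (λ j → F (g j))) ∣ ℤ.≤ m r t)
        × (∣ ⋂ (members (λ j → F (g j))) ∣ < t)
lemma3p1 n t k r _ F _ 1<k _ bounded nontrivial
  with FinP.all? (λ i → FinP.all? (λ j → t ≤? ∣ F i ∩ F j ∣))
... | no notPairwise =
  let i , j , few = failing-pair t F notPairwise in non-intersecting t r F bounded 1<k i j few
... | yes pairwise = intersecting t r F bounded 1<k pairwise fewCommon
  where
  fewCommon : ∣ ⋂ (map F (allFin k)) ∣ < t
  fewCommon = ≰⇒> λ common →
    nontrivial (pairwise , subst (λ as → t ≤ ∣ ⋂ as ∣) (LP.map-tabulate (λ i → i) F) common)
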